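{- Let $k$ be a positive integer, let $a\ge 1$ and $G=K_a\,\Box\,K_a$. Then $\gamma_{P,k}(G)=a-k$ if $a\ge k+2$, and $\gamma_{P,k}(G)=1$ otherwise.
   Context: $K_a$ is the complete graph on $a$ vertices and $\Box$ denotes the Cartesian product: $V(G\Box H)=V(G)\times V(H)$, with $(g,h)$ adjacent to $(g',h')$ iff either $g=g'$ and $hh'\in E(H)$, or $h=h'$ and $gg'\in E(G)$. $N_G[v]$ is the closed neighbourhood of $v$ and $N_G[S]=\bigcup_{v\in S}N_G[v]$. For $S\subseteq V(G)$, define $\mathcal{P}^{0}_{G,k}(S)=N_G[S]$ and $\mathcal{P}^{t+1}_{G,k}(S)=\bigcup\{N_G[u] : u\in \mathcal{P}^{t}_{G,k}(S),\ |N_G[u]\setminus \mathcal{P}^{t}_{G,k}(S)|\le k\}$; these sets increase and stabilize to $\mathcal{P}^{\infty}_{G,k}(S)$. $S$ is a $k$-power dominating set if $\mathcal{P}^{\infty}_{G,k}(S)=V(G)$; $\gamma_{P,k}(G)$ is the minimum size of such a set. -}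

module Defs where

open import Data.Nat using (ℕ; zero; suc; _*_; _≤_; _≤ᵇ_)
open import Data.Bool using (Bool; true; false; _∧_; _∨_; not)
open import Data.Fin using (Fin; remQuot)
open import Data.Fin.Properties using (_≟_)
open import Data.Fin.Subset using (Subset; ∣_∣; _─_)
open import Data.Vec using (tabulate; lookup)
open import Data.List using (allFin)
open import Data.Bool.ListAction using (any)
open import Data.Product using (_×_; _,_; ∃; ∃-syntax)
open import Relation.Nullary.Decidable using (⌊_⌋)
open import Relation.Binary.PropositionalEquality using (_≡_)

record Graph : Set where
  field
    n   : ℕ
    adj : Fin n → Fin n → Bool
open Graph public

K : ℕ → Graph
K a = record { n = a ; adj = λ i j → not ⌊ i ≟ j ⌋ }

_□_ : Graph → Graph → Graph
G □ H = record { n = n G * n H ; adj = ad }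
  where
  ad : Fin (n G * n H) → Fin (n G * n H) → Bool
  ad x y with remQuot (n H) x | remQuot (n H) y
  ... | g , h | g' , h' =
    (⌊ g ≟ g' ⌋ ∧ adj H h h') ∨ (⌊ h ≟ h' ⌋ ∧ adj G g g')

module _ (G : Graph) where

  N[_] : Fin (n G) → Subset (n G)
  N[ v ] = tabulate (λ u → ⌊ u ≟ v ⌋ ∨ adj G v u)

  N[_]ˢ : Subset (n G) → Subset (n G)
  N[ S ]ˢ = tabulate (λ w → any (λ v → lookup S v ∧ lookup N[ v ] w) (allFin (n G)))

  step : ℕ → Subset (n G) → Subset (n G)
  step k P = tabulate (λ w → any (λ u → lookup P u ∧ (∣ N[ u ] ─ P ∣ ≤ᵇ k) ∧ lookup N[ u ] w)
                                 (allFin (n G)))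

  𝒫 : ℕ → ℕ → Subset (n G) → Subset (n G)
  𝒫 k zero    S = N[ S ]ˢ
  𝒫 k (suc t) S = step k (𝒫 k t S)

  full : Subset (n G)
  full = tabulate (λ _ → true)

  -- S is k-power dominating: 𝒫^∞ = V(G); since the 𝒫^t increase, this is ∃ t, 𝒫^t = V(G).
  IsKPDS : ℕ → Subset (n G) → Set
  IsKPDS k S = ∃[ t ] (𝒫 k t S ≡ full)

  γPk≡ : ℕ → ℕ → Set
  γPk≡ k m = (∃[ S ] (∣ S ∣ ≡ m × IsKPDS k S)) × (∀ S → IsKPDS k S → m ≤ ∣ S ∣)

-- In the rook's graph K_a □ K_a the closed neighbourhood of a set S of cells is
-- the union of the rows and columns meeting S.  If k + |S| < a, a cell of N[S]
-- lying on a row of S and a column of S has its whole neighbourhood in N[S],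
-- while one lying on a row of S but on no column of S (or vice versa) has at
-- least a − |S| > k neighbours outside N[S]; so propagation never leaves N[S],
-- which misses a cell.  With the fact that the empty set forces nothing, this
-- gives both lower bounds.  Conversely m ≥ 1 diagonal cells with a − m ≤ k
-- dominate m full rows, and then each cell of such a row sees only the a − m
-- cells of its column outside, so a single propagation step fills the board.
module Submission where

open import Defs
open import Data.Bool using (Bool; T; _∧_)
open import Data.Bool.Properties using (T-≡; T-∧; T-∨)
open import Data.Bool.ListAction using (any)
open import Data.Fin using (Fin; zero; suc; combine; quotient; remainder; inject≤; fromℕ<)
open import Data.Fin.Properties
  using (_≟_; suc-injective; 0≢1+n; remQuot-combine; combine-remQuot; combine-injectiveˡ; combine-injectiveʳ; inject≤-injective)
open import Data.Fin.Subset
  using (Subset; inside; outside; _∈_; _∉_; _⊆_; ∣_∣; ⊤; ⁅_⁆; _∪_; _─_; _-_; ∁; Nonempty)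
  renaming (⊥ to ∅)
open import Data.Fin.Subset.Properties
  using (_∈?_; nonempty?; drop-there; ∉⊥; ∈⊤; x∈⁅x⁆; x∈⁅y⁆⇒x≡y; x∈p∪q⁺; x∈p∪q⁻; p─q⊆p; x∈p∧x∉q⇒x∈p─q;
         x∈p∧x≢y⇒x∈p-y; x∉p⇒x∈∁p; x∈∁p⇒x∉p; ⊆-antisym; p⊆q⇒∣p∣≤∣q∣; x∈p⇒∣p-x∣<∣p∣; ∣p∣≤∣x∷p∣;
         ∣⊥∣≡0; ∣⊤∣≡n; ∣⁅x⁆∣≡1; ∣∁p∣≡n∸∣p∣)
open import Data.List using (allFin)
open import Data.List.Membership.Propositional using (lose)
open import Data.List.Membership.Propositional.Properties using (∈-allFin)
open import Data.List.Relation.Unary.Any using (satisfied)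
open import Data.List.Relation.Unary.Any.Properties using (any⁺; any⁻)
open import Data.Nat using (ℕ; zero; suc; _+_; _*_; _∸_; _≤_; _<_; z≤n; s≤s; z<s; s≤s⁻¹)
open import Data.Nat.Properties
  using (module ≤-Reasoning; ≤-reflexive; ≤-trans; ≤-<-trans; <-≤-trans; ≤-antisym; <⇒≤; <⇒≱; ≮⇒≥;
         ≤⇒≤ᵇ; ≤ᵇ⇒≤; +-comm; +-suc; +-monoʳ-≤; ∸-monoʳ-≤; m<n⇒0<n; m<m+n; m≤n+m; m∸n≤m; m<n⇒0<n∸m;
         m∸[m∸n]≡n; m+n≤o⇒m≤o∸n; m≤o∸n⇒m+n≤o; m≤n+o⇒m∸n≤o)
open import Data.Product using (∃; _×_; _,_; proj₁; proj₂)
import Data.Product as Product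
open import Data.Sum using (_⊎_; inj₁; inj₂; [_,_])
import Data.Sum as Sum
open import Data.Vec using ([]; _∷_; here; there; lookup; tabulate)
open import Data.Vec.Properties using (lookup∘tabulate; lookup⇒[]=; []=⇒lookup)
open import Function using (id; _∘_; Equivalence; Injective)
open import Relation.Nullary using (¬_; yes; no; contradiction)
open import Relation.Nullary.Decidable using (⌊_⌋; toWitness; fromWitness; fromWitnessFalse)
open import Relation.Binary.PropositionalEquality using (_≡_; refl; sym; trans; cong; cong₂; subst)

private
  variable
    l m : ℕ
    x : Fin l
    p q : Subset l

-- Finite subsets

T-lookup⇒∈ : T (lookup p x) → x ∈ p
T-lookup⇒∈ {p = p} {x} = lookup⇒[]= x p ∘ Equivalence.to T-≡

∈⇒T-lookup : x ∈ p → T (lookup p x)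
∈⇒T-lookup = Equivalence.from T-≡ ∘ []=⇒lookup

∈-tabulate⁺ : {f : Fin l → Bool} → T (f x) → x ∈ tabulate f
∈-tabulate⁺ {x = x} {f} = T-lookup⇒∈ ∘ subst T (sym (lookup∘tabulate f x))

∈-tabulate⁻ : {f : Fin l → Bool} → x ∈ tabulate f → T (f x)
∈-tabulate⁻ {x = x} {f} = subst T (lookup∘tabulate f x) ∘ ∈⇒T-lookup

T-any-allFin⁺ : (f : Fin l → Bool) (x : Fin l) → T (f x) → T (any f (allFin l))
T-any-allFin⁺ f x fx = any⁺ f (lose (∈-allFin x) fx)

T-any-allFin⁻ : (f : Fin l → Bool) → T (any f (allFin l)) → ∃ (T ∘ f)
T-any-allFin⁻ {l = l} f = satisfied ∘ any⁻ f (allFin l)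

x∈p─q⇒x∉q : ∀ (p q : Subset l) → x ∈ p ─ q → x ∉ q
x∈p─q⇒x∉q (inside ∷ p) (outside ∷ q) here       = λ ()
x∈p─q⇒x∉q (_      ∷ p) (_       ∷ q) (there x∈) = x∈p─q⇒x∉q p q x∈ ∘ drop-there
x∈p─q⇒x∉q {x = zero} (outside ∷ p) (inside  ∷ q) ()
x∈p─q⇒x∉q {x = zero} (outside ∷ p) (outside ∷ q) ()

p⊆q⇒r─q⊆r─p : ∀ (r : Subset l) → p ⊆ q → r ─ q ⊆ r ─ p
p⊆q⇒r─q⊆r─p {q = q} r p⊆q x∈ = x∈p∧x∉q⇒x∈p─q (p─q⊆p r q x∈) (x∈p─q⇒x∉q r q x∈ ∘ p⊆q)

∣p∣<n⇒∃∉ : ∀ (p : Subset l) → ∣ p ∣ < l → ∃ (_∉ p)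
∣p∣<n⇒∃∉ (outside ∷ p) _           = zero , λ ()
∣p∣<n⇒∃∉ (inside  ∷ p) (s≤s ∣p∣<n) = Product.map suc (_∘ drop-there) (∣p∣<n⇒∃∉ p ∣p∣<n)

Nonempty⇒0<∣p∣ : Nonempty p → 0 < ∣ p ∣
Nonempty⇒0<∣p∣ (x , x∈p) = m<n⇒0<n (x∈p⇒∣p-x∣<∣p∣ x∈p)

∣p∪q∣≤∣p∣+∣q∣ : ∀ (p q : Subset l) → ∣ p ∪ q ∣ ≤ ∣ p ∣ + ∣ q ∣
∣p∪q∣≤∣p∣+∣q∣ []            []            = z≤n
∣p∪q∣≤∣p∣+∣q∣ (inside  ∷ p) (t       ∷ q) =
  s≤s (≤-trans (∣p∪q∣≤∣p∣+∣q∣ p q) (+-monoʳ-≤ ∣ p ∣ (∣p∣≤∣x∷p∣ t q)))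
∣p∪q∣≤∣p∣+∣q∣ (outside ∷ p) (inside  ∷ q) =
  subst (suc ∣ p ∪ q ∣ ≤_) (sym (+-suc ∣ p ∣ ∣ q ∣)) (s≤s (∣p∪q∣≤∣p∣+∣q∣ p q))
∣p∪q∣≤∣p∣+∣q∣ (outside ∷ p) (outside ∷ q) = ∣p∪q∣≤∣p∣+∣q∣ p q

image : (Fin m → Fin l) → Subset m → Subset l
image f []            = ∅
image f (outside ∷ p) = image (f ∘ suc) p
image f (inside  ∷ p) = ⁅ f zero ⁆ ∪ image (f ∘ suc) p

∈-image⁺ : ∀ (f : Fin m → Fin l) {p x} → x ∈ p → f x ∈ image f p
∈-image⁺ f               here        = x∈p∪q⁺ (inj₁ (x∈⁅x⁆ (f zero)))
∈-image⁺ f {outside ∷ p} (there x∈p) = ∈-image⁺ (f ∘ suc) x∈p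
∈-image⁺ f {inside  ∷ p} (there x∈p) = x∈p∪q⁺ (inj₂ (∈-image⁺ (f ∘ suc) x∈p))

∈-image⁻ : ∀ (f : Fin m → Fin l) p {y} → y ∈ image f p → ∃ λ x → x ∈ p × f x ≡ y
∈-image⁻ f []            y∈ = contradiction y∈ ∉⊥
∈-image⁻ f (outside ∷ p) y∈ = Product.map suc (Product.map₁ there) (∈-image⁻ (f ∘ suc) p y∈)
∈-image⁻ f (inside  ∷ p) y∈ with x∈p∪q⁻ ⁅ f zero ⁆ (image (f ∘ suc) p) y∈
... | inj₁ y∈⁅f0⁆ = zero , here , sym (x∈⁅y⁆⇒x≡y (f zero) y∈⁅f0⁆)
... | inj₂ y∈img  = Product.map suc (Product.map₁ there) (∈-image⁻ (f ∘ suc) p y∈img)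

∣image∣≤∣p∣ : ∀ (f : Fin m → Fin l) p → ∣ image f p ∣ ≤ ∣ p ∣
∣image∣≤∣p∣ {l = l} f []    = subst (_≤ 0) (sym (∣⊥∣≡0 l)) z≤n
∣image∣≤∣p∣ f (outside ∷ p) = ∣image∣≤∣p∣ (f ∘ suc) p
∣image∣≤∣p∣ f (inside  ∷ p) = begin
  ∣ ⁅ f zero ⁆ ∪ image (f ∘ suc) p ∣     ≤⟨ ∣p∪q∣≤∣p∣+∣q∣ ⁅ f zero ⁆ (image (f ∘ suc) p) ⟩
  ∣ ⁅ f zero ⁆ ∣ + ∣ image (f ∘ suc) p ∣ ≡⟨ cong (_+ ∣ image (f ∘ suc) p ∣) (∣⁅x⁆∣≡1 (f zero)) ⟩
  suc ∣ image (f ∘ suc) p ∣              ≤⟨ s≤s (∣image∣≤∣p∣ (f ∘ suc) p) ⟩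
  suc ∣ p ∣                              ∎
  where open ≤-Reasoning

InjectiveOn : (Fin m → Fin l) → Subset m → Set
InjectiveOn f p = ∀ {x y} → x ∈ p → y ∈ p → f x ≡ f y → x ≡ y

injectiveOn⇒∣p∣≤∣q∣ : ∀ (f : Fin m → Fin l) {p q} →
                      InjectiveOn f p → (∀ {x} → x ∈ p → f x ∈ q) → ∣ p ∣ ≤ ∣ q ∣
injectiveOn⇒∣p∣≤∣q∣ f {[]}          _   _  = z≤n
injectiveOn⇒∣p∣≤∣q∣ f {outside ∷ p} inj f∈ =
  injectiveOn⇒∣p∣≤∣q∣ (f ∘ suc) (λ x∈ y∈ → suc-injective ∘ inj (there x∈) (there y∈)) (f∈ ∘ there)
injectiveOn⇒∣p∣≤∣q∣ f {inside  ∷ p} {q} inj f∈ = begin-strict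
  ∣ p ∣          ≤⟨ injectiveOn⇒∣p∣≤∣q∣ (f ∘ suc) (λ x∈ y∈ → suc-injective ∘ inj (there x∈) (there y∈)) f∘suc∈q-f0 ⟩
  ∣ q - f zero ∣ <⟨ x∈p⇒∣p-x∣<∣p∣ (f∈ here) ⟩
  ∣ q ∣          ∎
  where
  open ≤-Reasoning
  f∘suc∈q-f0 : ∀ {x} → x ∈ p → f (suc x) ∈ q - f zero
  f∘suc∈q-f0 x∈p = x∈p∧x≢y⇒x∈p-y (f∈ (there x∈p)) (0≢1+n ∘ sym ∘ inj (there x∈p) here)

-- Power domination in an arbitrary graph

module _ (G : Graph) where

  private
    N : Fin (n G) → Subset (n G)
    N = N[_] G

    Nˢ : Subset (n G) → Subset (n G)
    Nˢ = N[_]ˢ G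

    variable
      k : ℕ
      u v w : Fin (n G)
      P Q S : Subset (n G)

  ∈N[]-refl : ∀ v → v ∈ N v
  ∈N[]-refl v = ∈-tabulate⁺ (Equivalence.from T-∨ (inj₁ (fromWitness {a? = v ≟ v} refl)))

  ∈N[]ˢ⁺ : v ∈ S → w ∈ N v → w ∈ Nˢ S
  ∈N[]ˢ⁺ {v = v} v∈S w∈Nv =
    ∈-tabulate⁺ (T-any-allFin⁺ _ v (Equivalence.from T-∧ (∈⇒T-lookup v∈S , ∈⇒T-lookup w∈Nv)))

  ∈N[]ˢ⁻ : ∀ S → w ∈ Nˢ S → ∃ λ v → v ∈ S × w ∈ N v
  ∈N[]ˢ⁻ S w∈ with T-any-allFin⁻ _ (∈-tabulate⁻ w∈)
  ... | v , Sv∧Nvw with Equivalence.to T-∧ Sv∧Nvw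
  ...   | Sv , Nvw = v , T-lookup⇒∈ Sv , T-lookup⇒∈ Nvw

  ∈step⁺ : u ∈ P → ∣ N u ─ P ∣ ≤ k → w ∈ N u → w ∈ step G k P
  ∈step⁺ {u = u} u∈P few w∈Nu = ∈-tabulate⁺ (T-any-allFin⁺ _ u (Equivalence.from T-∧
    (∈⇒T-lookup u∈P , Equivalence.from T-∧ (≤⇒≤ᵇ few , ∈⇒T-lookup w∈Nu))))

  ∈step⁻ : w ∈ step G k P → ∃ λ u → u ∈ P × ∣ N u ─ P ∣ ≤ k × w ∈ N u
  ∈step⁻ {k = k} {P = P} w∈ with T-any-allFin⁻ _ (∈-tabulate⁻ w∈)
  ... | u , Pu∧few∧Nuw with Equivalence.to T-∧ Pu∧few∧Nuw
  ...   | Pu , few∧Nuw with Equivalence.to T-∧ few∧Nuw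
  ...     | few , Nuw = u , T-lookup⇒∈ Pu , ≤ᵇ⇒≤ ∣ N u ─ P ∣ k few , T-lookup⇒∈ Nuw

  IsKPDS-intro : ∀ t → (∀ w → w ∈ 𝒫 G k t S) → IsKPDS G k S
  IsKPDS-intro t ∈𝒫 = t , ⊆-antisym (λ _ → ∈-tabulate⁺ _) (λ {w} _ → ∈𝒫 w)

  PropagationClosed : ℕ → Subset (n G) → Set
  PropagationClosed k Q = ∀ {u} → u ∈ Q → N u ⊆ Q ⊎ k < ∣ N u ─ Q ∣

  step⊆closed : PropagationClosed k Q → P ⊆ Q → step G k P ⊆ Q
  step⊆closed closed P⊆Q w∈ with ∈step⁻ w∈
  ... | u , u∈P , few , w∈Nu with closed (P⊆Q u∈P)
  ...   | inj₁ Nu⊆Q = Nu⊆Q w∈Nu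
  ...   | inj₂ many = contradiction (≤-trans (p⊆q⇒∣p∣≤∣q∣ (p⊆q⇒r─q⊆r─p (N u) P⊆Q)) few) (<⇒≱ many)

  𝒫⊆closed : ∀ S → Nˢ S ⊆ Q → PropagationClosed k Q → ∀ t → 𝒫 G k t S ⊆ Q
  𝒫⊆closed S NS⊆Q closed zero    = NS⊆Q
  𝒫⊆closed S NS⊆Q closed (suc t) = step⊆closed closed (𝒫⊆closed S NS⊆Q closed t)

  closed⇒¬IsKPDS : ∀ S {x} → Nˢ S ⊆ Q → PropagationClosed k Q → x ∉ Q → ¬ IsKPDS G k S
  closed⇒¬IsKPDS S {x} NS⊆Q closed x∉Q (t , 𝒫≡full) =
    x∉Q (𝒫⊆closed S NS⊆Q closed t (subst (x ∈_) (sym 𝒫≡full) (∈-tabulate⁺ _)))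

  IsKPDS⇒Nonempty : Fin (n G) → IsKPDS G k S → Nonempty S
  IsKPDS⇒Nonempty {S = S} x pds with nonempty? S
  ... | yes S≠∅ = S≠∅
  ... | no  S=∅ = contradiction pds (closed⇒¬IsKPDS S {x} NS⊆∅ (λ u∈∅ → contradiction u∈∅ ∉⊥) ∉⊥)
    where
    NS⊆∅ : Nˢ S ⊆ ∅
    NS⊆∅ w∈ with ∈N[]ˢ⁻ S w∈
    ... | v , v∈S , _ = contradiction (v , v∈S) S=∅

-- Neighbourhoods in complete graphs and Cartesian products

∈N[K] : ∀ {a} (i j : Fin a) → i ∈ N[_] (K a) j
∈N[K] i j with i ≟ j
... | yes i≡j = ∈-tabulate⁺ (Equivalence.from T-∨ (inj₁ (fromWitness {a? = i ≟ j} i≡j)))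
... | no  i≢j = ∈-tabulate⁺ (Equivalence.from (T-∨ {⌊ i ≟ j ⌋}) (inj₂ (fromWitnessFalse {a? = j ≟ i} (i≢j ∘ sym))))

module _ (G H : Graph) where

  private
    π₁ : Fin (n G * n H) → Fin (n G)
    π₁ = quotient (n H)

    π₂ : Fin (n G * n H) → Fin (n H)
    π₂ = remainder {n G} (n H)

  ≡-by-coordinates : ∀ {u v} → π₁ u ≡ π₁ v → π₂ u ≡ π₂ v → u ≡ v
  ≡-by-coordinates {u} {v} ≡₁ ≡₂ =
    trans (sym (combine-remQuot {n G} (n H) u)) (trans (cong₂ combine ≡₁ ≡₂) (combine-remQuot {n G} (n H) v))

  ∈N[]-□⁻ : ∀ {u v} → u ∈ N[_] (G □ H) v →
            (π₁ u ≡ π₁ v × π₂ u ∈ N[_] H (π₂ v)) ⊎ (π₂ u ≡ π₂ v × π₁ u ∈ N[_] G (π₁ v))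
  ∈N[]-□⁻ {u} {v} u∈ with Equivalence.to (T-∨ {⌊ u ≟ v ⌋}) (∈-tabulate⁻ u∈)
  ... | inj₁ u≡v with refl ← toWitness {a? = u ≟ v} u≡v = inj₁ (refl , ∈N[]-refl H (π₂ v))
  ... | inj₂ v~u with Equivalence.to (T-∨ {⌊ π₁ v ≟ π₁ u ⌋ ∧ adj H (π₂ v) (π₂ u)}) v~u
  ...   | inj₁ H-edge with Equivalence.to (T-∧ {⌊ π₁ v ≟ π₁ u ⌋}) H-edge
  ...     | ≡₁ , ~₂ = inj₁ (sym (toWitness ≡₁) , ∈-tabulate⁺ (Equivalence.from T-∨ (inj₂ ~₂)))
  ∈N[]-□⁻ {u} {v} u∈ | inj₂ v~u | inj₂ G-edge with Equivalence.to (T-∧ {⌊ π₂ v ≟ π₂ u ⌋}) G-edge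
  ...     | ≡₂ , ~₁ = inj₂ (sym (toWitness ≡₂) , ∈-tabulate⁺ (Equivalence.from T-∨ (inj₂ ~₁)))

  ∈N[]-□⁺ : ∀ {u v} → (π₁ u ≡ π₁ v × π₂ u ∈ N[_] H (π₂ v)) ⊎ (π₂ u ≡ π₂ v × π₁ u ∈ N[_] G (π₁ v)) →
            u ∈ N[_] (G □ H) v
  ∈N[]-□⁺ {u} {v} (inj₁ (≡₁ , ∈₂)) with Equivalence.to (T-∨ {⌊ π₂ u ≟ π₂ v ⌋}) (∈-tabulate⁻ ∈₂)
  ... | inj₁ ≡₂ with refl ← ≡-by-coordinates ≡₁ (toWitness ≡₂) = ∈N[]-refl (G □ H) u
  ... | inj₂ ~₂ = ∈-tabulate⁺ (Equivalence.from (T-∨ {⌊ u ≟ v ⌋}) (inj₂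
          (Equivalence.from T-∨ (inj₁ (Equivalence.from T-∧ (fromWitness {a? = π₁ v ≟ π₁ u} (sym ≡₁) , ~₂))))))
  ∈N[]-□⁺ {u} {v} (inj₂ (≡₂ , ∈₁)) with Equivalence.to (T-∨ {⌊ π₁ u ≟ π₁ v ⌋}) (∈-tabulate⁻ ∈₁)
  ... | inj₁ ≡₁ with refl ← ≡-by-coordinates (toWitness ≡₁) ≡₂ = ∈N[]-refl (G □ H) u
  ... | inj₂ ~₁ = ∈-tabulate⁺ (Equivalence.from (T-∨ {⌊ u ≟ v ⌋}) (inj₂
          (Equivalence.from T-∨ (inj₂ (Equivalence.from T-∧ (fromWitness {a? = π₂ v ≟ π₂ u} (sym ≡₂) , ~₁))))))

-- The rook's graph K_a □ K_a
module RooksGraph (a : ℕ) where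

  Rook : Graph
  Rook = K a □ K a

  private
    V : Set
    V = Fin (a * a)

    N : V → Subset (a * a)
    N = N[_] Rook

    Nˢ : Subset (a * a) → Subset (a * a)
    Nˢ = N[_]ˢ Rook

    variable
      k : ℕ
      S : Subset (a * a)
      u w : V

  row col : V → Fin a
  row = quotient a
  col = remainder {a} a

  ⟨_,_⟩ : Fin a → Fin a → V
  ⟨_,_⟩ = combine

  row-⟨⟩ : ∀ i j → row ⟨ i , j ⟩ ≡ i
  row-⟨⟩ i j = cong proj₁ (remQuot-combine i j)

  col-⟨⟩ : ∀ i j → col ⟨ i , j ⟩ ≡ j
  col-⟨⟩ i j = cong proj₂ (remQuot-combine i j)

  ∈N[]⇒sameLine : u ∈ N w → row u ≡ row w ⊎ col u ≡ col w
  ∈N[]⇒sameLine = Sum.map proj₁ proj₁ ∘ ∈N[]-□⁻ (K a) (K a)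

  sameLine⇒∈N[] : row u ≡ row w ⊎ col u ≡ col w → u ∈ N w
  sameLine⇒∈N[] = ∈N[]-□⁺ (K a) (K a) ∘ Sum.map (_, ∈N[K] _ _) (_, ∈N[K] _ _)

  rows cols : Subset (a * a) → Subset a
  rows = image row
  cols = image col

  ∈N[]ˢ⇒onLines : ∀ S → w ∈ Nˢ S → row w ∈ rows S ⊎ col w ∈ cols S
  ∈N[]ˢ⇒onLines S w∈ with ∈N[]ˢ⁻ Rook S w∈
  ... | v , v∈S , w∈Nv = Sum.map
    (λ e → subst (_∈ rows S) (sym e) (∈-image⁺ row v∈S))
    (λ e → subst (_∈ cols S) (sym e) (∈-image⁺ col v∈S))
    (∈N[]⇒sameLine w∈Nv)

  onLines⇒∈N[]ˢ : ∀ S → row w ∈ rows S ⊎ col w ∈ cols S → w ∈ Nˢ S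
  onLines⇒∈N[]ˢ S (inj₁ r∈) with ∈-image⁻ row S r∈
  ... | v , v∈S , row≡ = ∈N[]ˢ⁺ Rook v∈S (sameLine⇒∈N[] (inj₁ (sym row≡)))
  onLines⇒∈N[]ˢ S (inj₂ c∈) with ∈-image⁻ col S c∈
  ... | v , v∈S , col≡ = ∈N[]ˢ⁺ Rook v∈S (sameLine⇒∈N[] (inj₂ (sym col≡)))

  ⟨⟩∉N[]ˢ : ∀ S {i j} → i ∉ rows S → j ∉ cols S → ⟨ i , j ⟩ ∉ Nˢ S
  ⟨⟩∉N[]ˢ S {i} {j} i∉ j∉ ∈NS =
    [ i∉ ∘ subst (_∈ rows S) (row-⟨⟩ i j) , j∉ ∘ subst (_∈ cols S) (col-⟨⟩ i j) ] (∈N[]ˢ⇒onLines S ∈NS)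

  k<∣N[u]─N[S]∣ : ∀ S → k + ∣ S ∣ < a → ∀ (X : Subset a) → ∣ X ∣ ≤ ∣ S ∣ →
                  (f : Fin a → V) → Injective _≡_ _≡_ f →
                  (∀ {i} → i ∈ ∁ X → f i ∈ N u ─ Nˢ S) → k < ∣ N u ─ Nˢ S ∣
  k<∣N[u]─N[S]∣ {k = k} {u = u} S k+∣S∣<a X ∣X∣≤∣S∣ f f-inj f∈ = begin-strict
    k                 <⟨ m+n≤o⇒m≤o∸n (suc k) k+∣S∣<a ⟩
    a ∸ ∣ S ∣         ≤⟨ ∸-monoʳ-≤ a ∣X∣≤∣S∣ ⟩
    a ∸ ∣ X ∣         ≡⟨ sym (∣∁p∣≡n∸∣p∣ X) ⟩
    ∣ ∁ X ∣           ≤⟨ injectiveOn⇒∣p∣≤∣q∣ f (λ _ _ → f-inj) f∈ ⟩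
    ∣ N u ─ Nˢ S ∣    ∎
    where open ≤-Reasoning

  N[S]-closed : ∀ S → k + ∣ S ∣ < a → PropagationClosed Rook k (Nˢ S)
  N[S]-closed S k+∣S∣<a {u} u∈NS with row u ∈? rows S | col u ∈? cols S
  ... | yes r∈ | yes c∈ = inj₁ (onLines⇒∈N[]ˢ S ∘ Sum.map
          (λ e → subst (_∈ rows S) (sym e) r∈) (λ e → subst (_∈ cols S) (sym e) c∈) ∘ ∈N[]⇒sameLine)
  ... | yes _  | no c∉  = inj₂ (k<∣N[u]─N[S]∣ S k+∣S∣<a (rows S) (∣image∣≤∣p∣ row S) ⟨_, col u ⟩
          (λ {i} {j} → combine-injectiveˡ i (col u) j (col u))
          (λ {i} i∈ → x∈p∧x∉q⇒x∈p─q (sameLine⇒∈N[] (inj₂ (col-⟨⟩ i (col u))))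
                                     (⟨⟩∉N[]ˢ S (x∈∁p⇒x∉p i∈) c∉)))
  ... | no r∉  | yes _  = inj₂ (k<∣N[u]─N[S]∣ S k+∣S∣<a (cols S) (∣image∣≤∣p∣ col S) ⟨ row u ,_⟩
          (λ {j} {l} → combine-injectiveʳ (row u) j (row u) l)
          (λ {j} j∈ → x∈p∧x∉q⇒x∈p─q (sameLine⇒∈N[] (inj₁ (row-⟨⟩ (row u) j)))
                                     (⟨⟩∉N[]ˢ S r∉ (x∈∁p⇒x∉p j∈))))
  ... | no r∉  | no c∉  = contradiction (∈N[]ˢ⇒onLines S u∈NS) [ r∉ , c∉ ]

  k+∣S∣<a⇒¬IsKPDS : ∀ S → k + ∣ S ∣ < a → ¬ IsKPDS Rook k S
  k+∣S∣<a⇒¬IsKPDS {k = k} S k+∣S∣<a =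
    closed⇒¬IsKPDS Rook S id (N[S]-closed S k+∣S∣<a) (⟨⟩∉N[]ˢ S (proj₂ free-row) (proj₂ free-col))
    where
    lines<a : (line : V → Fin a) → ∣ image line S ∣ < a
    lines<a line = ≤-<-trans (∣image∣≤∣p∣ line S) (≤-<-trans (m≤n+m ∣ S ∣ k) k+∣S∣<a)
    free-row : ∃ (_∉ rows S)
    free-row = ∣p∣<n⇒∃∉ (rows S) (lines<a row)
    free-col : ∃ (_∉ cols S)
    free-col = ∣p∣<n⇒∃∉ (cols S) (lines<a col)

  ∣N[u]─N[S]∣≤a∸∣rows∣ : ∀ S → row u ∈ rows S → ∣ N u ─ Nˢ S ∣ ≤ a ∸ ∣ rows S ∣
  ∣N[u]─N[S]∣≤a∸∣rows∣ {u = u} S r∈ = begin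
    ∣ N u ─ Nˢ S ∣  ≤⟨ injectiveOn⇒∣p∣≤∣q∣ row row-injectiveOn (x∉p⇒x∈∁p ∘ proj₂ ∘ unseen) ⟩
    ∣ ∁ (rows S) ∣  ≡⟨ ∣∁p∣≡n∸∣p∣ (rows S) ⟩
    a ∸ ∣ rows S ∣  ∎
    where
    open ≤-Reasoning
    unseen : ∀ {x} → x ∈ N u ─ Nˢ S → col x ≡ col u × row x ∉ rows S
    unseen {x} x∈ with ∈N[]⇒sameLine (p─q⊆p (N u) (Nˢ S) x∈)
    ... | inj₁ row≡ = contradiction (onLines⇒∈N[]ˢ S (inj₁ (subst (_∈ rows S) (sym row≡) r∈))) (x∈p─q⇒x∉q (N u) (Nˢ S) x∈)
    ... | inj₂ col≡ = col≡ , x∈p─q⇒x∉q (N u) (Nˢ S) x∈ ∘ onLines⇒∈N[]ˢ S ∘ inj₁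
    row-injectiveOn : InjectiveOn row (N u ─ Nˢ S)
    row-injectiveOn x∈ y∈ row≡ = ≡-by-coordinates (K a) (K a) row≡ (trans (proj₁ (unseen x∈)) (sym (proj₁ (unseen y∈))))

  module _ {m} (m≤a : m ≤ a) where

    private
      ι : Fin m → Fin a
      ι i = inject≤ i m≤a

      diag : Fin m → V
      diag i = ⟨ ι i , ι i ⟩

      diag-injective : Injective _≡_ _≡_ diag
      diag-injective {i} {j} e = inject≤-injective m≤a m≤a i j (combine-injectiveˡ (ι i) (ι i) (ι j) (ι j) e)

    diagonal : Subset (a * a)
    diagonal = image diag ⊤

    ∣diagonal∣≡m : ∣ diagonal ∣ ≡ m
    ∣diagonal∣≡m = ≤-antisym
      (subst (∣ diagonal ∣ ≤_) (∣⊤∣≡n m) (∣image∣≤∣p∣ diag ⊤))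
      (subst (_≤ ∣ diagonal ∣) (∣⊤∣≡n m) (injectiveOn⇒∣p∣≤∣q∣ diag {⊤} (λ _ _ → diag-injective) (∈-image⁺ diag)))

    ι∈rows-diagonal : ∀ i → ι i ∈ rows diagonal
    ι∈rows-diagonal i = subst (_∈ rows diagonal) (row-⟨⟩ (ι i) (ι i)) (∈-image⁺ row (∈-image⁺ diag ∈⊤))

    m≤∣rows-diagonal∣ : m ≤ ∣ rows diagonal ∣
    m≤∣rows-diagonal∣ = subst (_≤ ∣ rows diagonal ∣) (∣⊤∣≡n m)
      (injectiveOn⇒∣p∣≤∣q∣ ι {⊤} (λ {i} {j} _ _ → inject≤-injective m≤a m≤a i j) (λ {i} _ → ι∈rows-diagonal i))

    diagonal-IsKPDS : 0 < m → a ∸ m ≤ k → IsKPDS Rook k diagonal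
    diagonal-IsKPDS {k = k} 0<m a∸m≤k = IsKPDS-intro Rook 1 λ w →
      ∈step⁺ Rook (pivot∈N[diagonal] w) (few w) (sameLine⇒∈N[] (inj₂ (sym (col-⟨⟩ (ι i₀) (col w)))))
      where
      i₀ : Fin m
      i₀ = fromℕ< 0<m

      pivot : V → V
      pivot w = ⟨ ι i₀ , col w ⟩

      pivot-row : ∀ w → row (pivot w) ∈ rows diagonal
      pivot-row w = subst (_∈ rows diagonal) (sym (row-⟨⟩ (ι i₀) (col w))) (ι∈rows-diagonal i₀)

      pivot∈N[diagonal] : ∀ w → pivot w ∈ Nˢ diagonal
      pivot∈N[diagonal] w = onLines⇒∈N[]ˢ diagonal (inj₁ (pivot-row w))

      few : ∀ w → ∣ N (pivot w) ─ Nˢ diagonal ∣ ≤ k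
      few w = begin
        ∣ N (pivot w) ─ Nˢ diagonal ∣ ≤⟨ ∣N[u]─N[S]∣≤a∸∣rows∣ diagonal (pivot-row w) ⟩
        a ∸ ∣ rows diagonal ∣          ≤⟨ ∸-monoʳ-≤ a m≤∣rows-diagonal∣ ⟩
        a ∸ m                          ≤⟨ a∸m≤k ⟩
        k                              ∎
        where open ≤-Reasoning

mainTheorem6 : (k a : ℕ) → 1 ≤ k → 1 ≤ a →
    (k + 2 ≤ a → γPk≡ (K a □ K a) k (a ∸ k)) × (a < k + 2 → γPk≡ (K a □ K a) k 1)
mainTheorem6 k a _ 0<a = when-a≥k+2 , when-a<k+2
  where
  open RooksGraph a

  when-a≥k+2 : k + 2 ≤ a → γPk≡ (K a □ K a) k (a ∸ k)
  when-a≥k+2 k+2≤a =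
    (diagonal a∸k≤a , ∣diagonal∣≡m a∸k≤a , diagonal-IsKPDS a∸k≤a (m<n⇒0<n∸m k<a) (≤-reflexive (m∸[m∸n]≡n (<⇒≤ k<a)))) ,
    λ S pds → ≮⇒≥ λ ∣S∣<a∸k →
      k+∣S∣<a⇒¬IsKPDS S (subst (_< a) (+-comm ∣ S ∣ k) (m≤o∸n⇒m+n≤o (suc ∣ S ∣) (<⇒≤ k<a) ∣S∣<a∸k)) pds
    where
    k<a : k < a
    k<a = <-≤-trans (m<m+n k z<s) k+2≤a
    a∸k≤a : a ∸ k ≤ a
    a∸k≤a = m∸n≤m a k

  when-a<k+2 : a < k + 2 → γPk≡ (K a □ K a) k 1
  when-a<k+2 a<k+2 =
    (diagonal 0<a , ∣diagonal∣≡m 0<a , diagonal-IsKPDS 0<a z<s (m≤n+o⇒m∸n≤o a 1 (s≤s⁻¹ (subst (a <_) (+-comm k 2) a<k+2)))) ,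
    λ S pds → Nonempty⇒0<∣p∣ (IsKPDS⇒Nonempty (K a □ K a) ⟨ fromℕ< 0<a , fromℕ< 0<a ⟩ pds)
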